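{- Let $P$ be a standard parabolic subgroup of $\mathrm{GL}_n$ and $C_P$ an isotypic component of $\overline{L}^{\otimes}|_{Z_{M_P}}$. For any $w,w'\in W(C_P)$ we have $w'w^{ -1}\in W(P(C_P))$; equivalently $W(C_P)\subseteq W(P(C_P))w$ for any fixed $w\in W(C_P)$.
   Context: $G=\mathrm{GL}_n$ over a finite field, $T$ diagonal, $B$ upper triangular, $X(T)=\bigoplus\mathbb{Z}e_i$, simple roots $S$, Weyl group $W$; dominance in $X(T)\otimes\mathbb{Q}$ means $\langle\lambda,\alpha\rangle\ge0$ for $\alpha\in S$. For a standard parabolic $P$: Levi $M_P\supseteq T$ with centre $Z_{M_P}$, simple roots $S(P)$, Weyl group $W(P)$; for $w(S(P))\subseteq S$, ${}^wP$ is the standard parabolic with simple roots $w(S(P))$. $\theta_G=\sum_{i=1}^{n-1}(e_1+\dots+e_i)$, $f\ge1$, $\overline{L}^{\otimes}=\bigotimes_{j=1}^f(\bigotimes_{i=1}^{n-1}\bigwedge^i\mathrm{Std})$ as a representation of $f$ copies of $G$, with $Z_{M_P}$ acting diagonally. Let $C_P$ be the isotypic component associated to $\lambda|_{Z_{M_P}}$, $\lambda\in X(T)$, and $\lambda'=\frac1{|W(P)|}\sum_{w'\in W(P)}w'(\lambda)$. $W(C_P)$ is the set of $w\in W$ with $w(S(P))\subseteq S$ and $w(\lambda')$ dominant (independent of the choice of $\lambda$). $P(C_P)$ is the standard parabolic whose set of simple roots is $w(S(P))\cup\{\alpha\in S:m_\alpha\ne0\}$, where $w\in W(C_P)$ and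 $f\theta_G-w(\lambda)=\sum_\alpha m_\alpha\alpha$ (this is independent of choices); $W(P(C_P))$ is its Weyl group. -}

module Defs where

open import Data.Nat as ℕ using (ℕ; zero; suc; _≤ᵇ_; _<ᵇ_)
open import Data.Integer as ℤ using (ℤ; +_; 0ℤ; 1ℤ)
open import Data.Rational as ℚ using (ℚ; 0ℚ)
open import Data.Fin as Fin using (Fin; zero; suc; toℕ; inject₁)
open import Data.Fin.Permutation using (Permutation′; _⟨$⟩ʳ_; _⟨$⟩ˡ_)
open import Data.Fin.Subset using (Subset; ∣_∣)
open import Data.Vec using (lookup)
open import Data.Bool using (Bool; true; false; if_then_else_; _∧_; _∨_; not)
open import Data.Product using (Σ; ∃; _×_; _,_)
open import Data.Sum using (_⊎_)
open import Relation.Binary.PropositionalEquality using (_≡_)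
open import Relation.Nullary using (¬_)
open import Relation.Nullary.Decidable using (⌊_⌋)

-- G = GL_n with n = suc m (so n ≥ 1).  X(T) = ℤ^n is
-- Fin n → ℤ (coordinates 0-based).  W = S_n = Permutation′ n, acting by w(e_j) = e_{w j},
-- i.e. (w·λ)_i = λ_{w⁻¹ i}.  A standard parabolic P is given by its set
-- of simple roots S(P), a predicate on Fin m.

∑ : ∀ {k} → (Fin k → ℤ) → ℤ
∑ {zero}  g = 0ℤ
∑ {suc k} g = g zero ℤ.+ ∑ (λ i → g (suc i))

∑ℕ : ∀ {k} → (Fin k → ℕ) → ℕ
∑ℕ {zero}  g = 0
∑ℕ {suc k} g = g zero ℕ.+ ∑ℕ (λ i → g (suc i))

allᵇ : ∀ {k} → (Fin k → Bool) → Bool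
allᵇ {zero}  g = true
allᵇ {suc k} g = g zero ∧ allᵇ (λ i → g (suc i))

e : ∀ {n} → Fin n → Fin n → ℤ
e i j = if ⌊ i Fin.≟ j ⌋ then 1ℤ else 0ℤ

α : ∀ {m} → Fin m → Fin (suc m) → ℤ
α k j = e (inject₁ k) j ℤ.- e (suc k) j

act : ∀ {n} {A : Set} → Permutation′ n → (Fin n → A) → (Fin n → A)
act w v i = v (w ⟨$⟩ˡ i)

-- dominance in X(T) ⊗ ℚ : ⟨λ , α_k^∨⟩ = λ_k - λ_{k+1} ≥ 0
DominantQ : ∀ {m} → (Fin (suc m) → ℚ) → Set
DominantQ {m} v = ∀ (k : Fin m) → v (suc k) ℚ.≤ v (inject₁ k)

-- Blocks of a standard Levi with simple roots Q: i and j lie in the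
-- same block iff every simple root α_k between them lies in Q.

Between : ∀ {m} → Fin m → Fin (suc m) → Fin (suc m) → Set
Between k i j =
  (toℕ i ℕ.≤ toℕ k × toℕ k ℕ.< toℕ j) ⊎ (toℕ j ℕ.≤ toℕ k × toℕ k ℕ.< toℕ i)

SameBlock : ∀ {m} → (Fin m → Set) → Fin (suc m) → Fin (suc m) → Set
SameBlock {m} Q i j = ∀ (k : Fin m) → Between k i j → Q k

betweenᵇ : ∀ {m} → Fin m → Fin (suc m) → Fin (suc m) → Bool
betweenᵇ k i j =
  ((toℕ i ≤ᵇ toℕ k) ∧ (toℕ k <ᵇ toℕ j)) ∨ ((toℕ j ≤ᵇ toℕ k) ∧ (toℕ k <ᵇ toℕ i))

sameBlockᵇ : ∀ {m} → (Fin m → Bool) → Fin (suc m) → Fin (suc m) → Bool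
sameBlockᵇ P i j = allᵇ (λ k → not (betweenᵇ k i j) ∨ P k)

-- Weyl group W(Q) of the Levi M_Q (block-preserving permutations), as a
-- membership predicate for a map Fin n → Fin n
InW : ∀ {m} → (Fin m → Set) → (Fin (suc m) → Fin (suc m)) → Set
InW Q u = ∀ j → SameBlock Q j (u j)

rootsOf : ∀ {m} → (Fin m → Bool) → Fin m → Set
rootsOf P k = P k ≡ true

-- Restriction to Z_{M_P} ≅ G_m^{#blocks}: λ|_Z is the tuple of block sums.

blockSum : ∀ {m} → (Fin m → Bool) → (Fin (suc m) → ℤ) → Fin (suc m) → ℤ
blockSum P v i = ∑ (λ j → if sameBlockᵇ P i j then v j else 0ℤ)

blockSize : ∀ {m} → (Fin m → Bool) → Fin (suc m) → ℕ
blockSize P i = ∑ℕ (λ j → if sameBlockᵇ P i j then 1 else 0)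

ResEq : ∀ {m} → (Fin m → Bool) → (Fin (suc m) → ℤ) → (Fin (suc m) → ℤ) → Set
ResEq P v μ = ∀ i → blockSum P v i ≡ blockSum P μ i

-- a / k  (k is never 0 below, since the block of i contains i)
avg : ℤ → ℕ → ℚ
avg a zero    = 0ℚ
avg a (suc k) = a ℚ./ suc k

-- λ' = (1/|W(P)|) Σ_{w' ∈ W(P)} w'(λ) : the block-wise average of λ
avgW : ∀ {m} → (Fin m → Bool) → (Fin (suc m) → ℤ) → Fin (suc m) → ℚ
avgW P v i = avg (blockSum P v i) (blockSize P i)

-- T-weights of  L̄^⊗ = ⊗_{j=1}^f ⊗_{i=1}^{n-1} ∧^i Std  (Z, T acting
-- diagonally): sums over j, i of e_I with |I| = i.

IsWeightL : (f m : ℕ) → (Fin (suc m) → ℤ) → Set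
IsWeightL f m μ =
  Σ (Fin f → Fin m → Subset (suc m)) λ I →
    (∀ j i → ∣ I j i ∣ ≡ suc (toℕ i)) ×
    (∀ t → μ t ≡ ∑ (λ j → ∑ (λ i → if lookup (I j i) t then 1ℤ else 0ℤ)))

-- θ_G = Σ_{i=1}^{n-1} (e_1 + … + e_i)
θ : (m : ℕ) → Fin (suc m) → ℤ
θ m t = ∑ (λ (i : Fin m) → if toℕ t ≤ᵇ toℕ i then 1ℤ else 0ℤ)

MapsIntoS : ∀ {m} → Permutation′ (suc m) → (Fin m → Bool) → Set
MapsIntoS {m} w P =
  ∀ k → P k ≡ true → ∃ λ (l : Fin m) → ∀ t → act w (α k) t ≡ α l t

-- w ∈ W(C_P), C_P the isotypic component attached to λ|_{Z_{M_P}}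
InWC : ∀ {m} → (Fin m → Bool) → (Fin (suc m) → ℤ) → Permutation′ (suc m) → Set
InWC P v w = MapsIntoS w P × DominantQ (act w (avgW P v))

RootCoeffs : (f m : ℕ) → (Fin (suc m) → ℤ) → Permutation′ (suc m) → (Fin m → ℤ) → Set
RootCoeffs f m v w c =
  ∀ t → (+ f) ℤ.* θ m t ℤ.- act w v t ≡ ∑ (λ l → c l ℤ.* α l t)

-- simple roots of P(C_P):  w(S(P)) ∪ {α_l : c_l ≠ 0}
rootsPC : ∀ {m} → (Fin m → Bool) → Permutation′ (suc m) → (Fin m → ℤ) → Fin m → Set
rootsPC {m} P w c l =
  (∃ λ (k : Fin m) → P k ≡ true × (∀ t → act w (α k) t ≡ α l t)) ⊎ ¬ (c l ≡ 0ℤ)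

-- Write λ' for the block averages of λ.  Every w(λ') with w ∈ W(C_P) is a dominant
-- rearrangement of λ', so they all coincide with z = w''(λ'); hence z(w' w⁻¹ j) = z(j), and the
-- antitone vector z is constant on the whole interval between j and w' w⁻¹ j.  So it suffices that
-- every simple root α_k with z_k = z_{k+1} lies in P(C_P).  If the coefficient c_k vanishes and
-- α_k ∉ w''(S(P)), then A = w''⁻¹{0,…,k} is a union of blocks of M_P and
-- c_k = Σ_{t≤k} (fθ_G − w''λ)_t = 0 says Σ_A μ = Σ_A λ = f Σ_{t≤k} θ_t.  For a weight μ of L̄^⊗
-- this is the largest value Σ_A μ can take on a set of size k+1, and equality forces every
-- exterior-power factor to be nested with A; then μ is strictly larger on A than off A.  The blocks
-- of w''⁻¹(k) ⊆ A and of w''⁻¹(k+1) ⊆ ∁A would then have different μ-averages, hence different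
-- λ-averages, contradicting z_k = z_{k+1}.

module Submission where

open import Defs
open import Data.Nat using (ℕ; zero; suc; z≤n; s≤s; _≤ᵇ_; _<ᵇ_; _≤_; _<_)
import Data.Nat.Properties as ℕP
open import Data.Integer as ℤ using (ℤ; 0ℤ; 1ℤ; _+_; _*_; _-_; -_; +≤+; +<+)
  renaming (+_ to pos)
import Data.Integer.Properties as ℤP
open import Data.Rational as ℚ using (ℚ)
import Data.Rational.Properties as ℚP
open import Data.Rational.Unnormalised using (mkℚᵘ; *≡*)
open import Data.Fin as Fin using (Fin; zero; suc; toℕ; inject₁)
import Data.Fin.Properties as FP
open import Data.Fin.Permutation using (Permutation′; _⟨$⟩ʳ_; _⟨$⟩ˡ_; inverseˡ; inverseʳ; flip; _∘ₚ_)
open import Data.Bool using (Bool; true; false; if_then_else_; _∧_; _∨_; not)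
import Data.Bool.Properties as BP
open import Data.Fin.Subset using (Subset; ∣_∣)
open import Data.Vec using ([]; _∷_; lookup)
open import Function.Bundles using (Equivalence)
open import Relation.Binary.Definitions using (tri<; tri≈; tri>)
open import Relation.Nullary.Decidable using (_×-dec_)
open import Data.Sum using (inj₁; inj₂)
open import Data.Product using (∃; _×_; _,_; proj₁)
open import Data.Empty using (⊥-elim)
open import Function using (_∘_)
open import Relation.Binary.PropositionalEquality
open import Relation.Nullary using (yes; no; ofʸ)
open import Algebra.Properties.Semiring.Sum ℤP.+-*-semiring
  using (sum; ∑-distrib-+; ∑-comm; ∑-permute; *-distribˡ-sum)
open import Data.Integer.Solver using (module +-*-Solver)
open +-*-Solver using (solve; _:*_; _:-_; _:=_)

∑≡sum : ∀ {k} (g : Fin k → ℤ) → ∑ g ≡ sum g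
∑≡sum {zero}  g = refl
∑≡sum {suc k} g = cong (g zero +_) (∑≡sum (g ∘ suc))

∑-cong : ∀ {k} {g h : Fin k → ℤ} → g ≗ h → ∑ g ≡ ∑ h
∑-cong {zero}  eq = refl
∑-cong {suc k} eq = cong₂ _+_ (eq zero) (∑-cong (eq ∘ suc))

∑-zero : ∀ k → ∑ {k} (λ _ → 0ℤ) ≡ 0ℤ
∑-zero zero    = refl
∑-zero (suc k) = trans (ℤP.+-identityˡ _) (∑-zero k)

∑-+ : ∀ {k} (g h : Fin k → ℤ) → ∑ (λ i → g i + h i) ≡ ∑ g + ∑ h
∑-+ g h rewrite ∑≡sum g | ∑≡sum h | ∑≡sum (λ i → g i + h i) = ∑-distrib-+ g h

∑-*ˡ : ∀ {k} (x : ℤ) (g : Fin k → ℤ) → ∑ (λ i → x * g i) ≡ x * ∑ g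
∑-*ˡ x g rewrite ∑≡sum g | ∑≡sum (λ i → x * g i) = sym (*-distribˡ-sum x g)

∑-swap : ∀ {a b} (g : Fin a → Fin b → ℤ) → ∑ (λ i → ∑ (g i)) ≡ ∑ (λ j → ∑ (λ i → g i j))
∑-swap g = begin
  ∑ (λ i → ∑ (g i))            ≡⟨ ∑-cong (∑≡sum ∘ g) ⟩
  ∑ (λ i → sum (g i))          ≡⟨ ∑≡sum (λ i → sum (g i)) ⟩
  sum (λ i → sum (g i))        ≡⟨ ∑-comm g ⟩
  sum (λ j → sum (λ i → g i j)) ≡⟨ ∑≡sum (λ j → sum (λ i → g i j)) ⟨
  ∑ (λ j → sum (λ i → g i j))  ≡⟨ ∑-cong (λ j → ∑≡sum (λ i → g i j)) ⟨
  ∑ (λ j → ∑ (λ i → g i j))    ∎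
  where open ≡-Reasoning

∑-permute′ : ∀ {k} (g : Fin k → ℤ) (π : Permutation′ k) → ∑ g ≡ ∑ (λ i → g (π ⟨$⟩ʳ i))
∑-permute′ g π rewrite ∑≡sum g | ∑≡sum (λ i → g (π ⟨$⟩ʳ i)) = ∑-permute g π

∑-neg : ∀ {k} (g : Fin k → ℤ) → ∑ (λ i → - g i) ≡ - ∑ g
∑-neg g = begin
  ∑ (λ i → - g i)        ≡⟨ ∑-cong (λ i → ℤP.-1*i≡-i (g i)) ⟨
  ∑ (λ i → - 1ℤ * g i)   ≡⟨ ∑-*ˡ (- 1ℤ) g ⟩
  - 1ℤ * ∑ g             ≡⟨ ℤP.-1*i≡-i (∑ g) ⟩
  - ∑ g                  ∎
  where open ≡-Reasoning

∑-- : ∀ {k} (g h : Fin k → ℤ) → ∑ (λ i → g i - h i) ≡ ∑ g - ∑ h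
∑-- g h = trans (∑-+ g (λ i → - h i)) (cong (∑ g +_) (∑-neg h))

∑-const : ∀ k (x : ℤ) → ∑ {k} (λ _ → x) ≡ pos k * x
∑-const zero    x = sym (ℤP.*-zeroˡ x)
∑-const (suc k) x = begin
  x + ∑ {k} (λ _ → x)   ≡⟨ cong (x +_) (∑-const k x) ⟩
  x + pos k * x         ≡⟨ cong (_+ pos k * x) (ℤP.*-identityˡ x) ⟨
  1ℤ * x + pos k * x    ≡⟨ ℤP.*-distribʳ-+ x 1ℤ (pos k) ⟨
  pos (suc k) * x       ∎
  where open ≡-Reasoning

∑-mono-≤ : ∀ {k} {g h : Fin k → ℤ} → (∀ i → g i ℤ.≤ h i) → ∑ g ℤ.≤ ∑ h
∑-mono-≤ {zero}  g≤h = ℤP.≤-refl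
∑-mono-≤ {suc k} g≤h = ℤP.+-mono-≤ (g≤h zero) (∑-mono-≤ (g≤h ∘ suc))

∑-mono-< : ∀ {k} {g h : Fin k → ℤ} → (∀ i → g i ℤ.≤ h i) →
           ∀ a → g a ℤ.< h a → ∑ g ℤ.< ∑ h
∑-mono-< g≤h zero    g<h = ℤP.+-mono-<-≤ g<h (∑-mono-≤ (g≤h ∘ suc))
∑-mono-< g≤h (suc a) g<h = ℤP.+-mono-≤-< (g≤h zero) (∑-mono-< (g≤h ∘ suc) a g<h)

∑-≤∧≡⇒≗ : ∀ {k} {g h : Fin k → ℤ} → (∀ i → g i ℤ.≤ h i) → ∑ g ≡ ∑ h → g ≗ h
∑-≤∧≡⇒≗ {g = g} {h} g≤h ∑g≡∑h a with g a ℤ.≟ h a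
... | yes ga≡ha = ga≡ha
... | no  ga≢ha = ⊥-elim (ℤP.<-irrefl ∑g≡∑h (∑-mono-< g≤h a (ℤP.≤∧≢⇒< (g≤h a) ga≢ha)))

∑[*∑]≡∑∑ : ∀ {a b} (g : Fin a → ℤ) (h : Fin a → Fin b → ℤ) →
        ∑ (λ s → g s * ∑ (h s)) ≡ ∑ (λ i → ∑ (λ s → g s * h s i))
∑[*∑]≡∑∑ g h = trans (∑-cong (λ s → sym (∑-*ˡ (g s) (h s)))) (∑-swap (λ s i → g s * h s i))

∑-*ʳ : ∀ {k} (x : ℤ) (g : Fin k → ℤ) → ∑ (λ i → g i * x) ≡ ∑ g * x
∑-*ʳ x g = trans (∑-cong (λ i → ℤP.*-comm (g i) x)) (trans (∑-*ˡ x g) (ℤP.*-comm x (∑ g)))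

∑*∑≡∑∑ : ∀ {a b} (g : Fin a → ℤ) (h : Fin b → ℤ) →
      ∑ g * ∑ h ≡ ∑ (λ s → ∑ (λ t → g s * h t))
∑*∑≡∑∑ g h = trans (sym (∑-*ʳ (∑ h) g)) (∑-cong (λ s → sym (∑-*ˡ (g s) h)))

∑ℕ-pos : ∀ {k} (g : Fin k → ℕ) → pos (∑ℕ g) ≡ ∑ (λ i → pos (g i))
∑ℕ-pos {zero}  g = refl
∑ℕ-pos {suc k} g =
  trans (ℤP.pos-+ (g zero) (∑ℕ (g ∘ suc))) (cong (pos (g zero) +_) (∑ℕ-pos (g ∘ suc)))

∑-act : ∀ {n} (w : Permutation′ n) (g v : Fin n → ℤ) →
        ∑ (λ t → g t * act w v t) ≡ ∑ (λ s → g (w ⟨$⟩ʳ s) * v s)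
∑-act w g v = trans (∑-permute′ (λ t → g t * act w v t) w)
                    (∑-cong (λ s → cong (λ r → g (w ⟨$⟩ʳ s) * v r) (inverseˡ w)))

ind : Bool → ℤ
ind b = if b then 1ℤ else 0ℤ

count : ∀ {n} → (Fin n → Bool) → ℤ
count B = ∑ (λ s → ind (B s))

_⊆ᵇ_ : ∀ {n} → (Fin n → Bool) → (Fin n → Bool) → Set
B ⊆ᵇ C = ∀ s → B s ≡ true → C s ≡ true

ind-∧ : ∀ b c → ind (b ∧ c) ≡ ind b * ind c
ind-∧ true  c = sym (ℤP.*-identityˡ (ind c))
ind-∧ false c = refl

ind-nonneg : ∀ b → 0ℤ ℤ.≤ ind b
ind-nonneg true  = +≤+ z≤n
ind-nonneg false = +≤+ z≤n

ind-mono : ∀ {b c} → (b ≡ true → c ≡ true) → ind b ℤ.≤ ind c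
ind-mono {true}  b⇒c rewrite b⇒c refl = ℤP.≤-refl
ind-mono {false} b⇒c = ind-nonneg _

ind-< : ∀ {b c} → b ≡ false → c ≡ true → ind b ℤ.< ind c
ind-< refl refl = +<+ (s≤s z≤n)

ind-injective : ∀ {b c} → ind b ≡ ind c → b ≡ c
ind-injective {true}  {true}  _  = refl
ind-injective {false} {false} _  = refl
ind-injective {true}  {false} ()
ind-injective {false} {true}  ()

ind*-mono-≤ : ∀ b {x y} → (b ≡ true → x ℤ.≤ y) → ind b * x ℤ.≤ ind b * y
ind*-mono-≤ true  {x} {y} x≤y =
  subst₂ ℤ._≤_ (sym (ℤP.*-identityˡ x)) (sym (ℤP.*-identityˡ y)) (x≤y refl)
ind*-mono-≤ false x≤y = ℤP.≤-refl

ind*-mono-< : ∀ {b x y} → b ≡ true → x ℤ.< y → ind b * x ℤ.< ind b * y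
ind*-mono-< {x = x} {y} refl = subst₂ ℤ._<_ (sym (ℤP.*-identityˡ x)) (sym (ℤP.*-identityˡ y))

count-mono : ∀ {n} {B C : Fin n → Bool} → B ⊆ᵇ C → count B ℤ.≤ count C
count-mono B⊆C = ∑-mono-≤ (λ s → ind-mono (B⊆C s))

count-pos : ∀ {n} {B : Fin n → Bool} a → B a ≡ true → 0ℤ ℤ.< count B
count-pos {n} {B} a Ba =
  subst (ℤ._< count B) (∑-zero n) (∑-mono-< (λ s → ind-nonneg (B s)) a (ind-< refl Ba))

count-⊆∧≡⇒⊇ : ∀ {n} {B C : Fin n → Bool} → B ⊆ᵇ C → count B ≡ count C → C ⊆ᵇ B
count-⊆∧≡⇒⊇ B⊆C #B≡#C s Cs =
  trans (ind-injective (∑-≤∧≡⇒≗ (λ t → ind-mono (B⊆C t)) #B≡#C s)) Cs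

count-lookup : ∀ {n} (p : Subset n) → pos ∣ p ∣ ≡ count (lookup p)
count-lookup []          = refl
count-lookup (true ∷ p)  = cong (1ℤ +_) (count-lookup p)
count-lookup (false ∷ p) = trans (count-lookup p) (sym (ℤP.+-identityˡ _))

count-permute : ∀ {n} (w : Permutation′ n) (B : Fin n → Bool) → count (λ s → B (w ⟨$⟩ʳ s)) ≡ count B
count-permute w B = sym (∑-permute′ (ind ∘ B) w)

initial : ∀ {n} → ℕ → Fin n → Bool
initial c t = toℕ t ≤ᵇ c

initial-true : ∀ {n c} {t : Fin n} → toℕ t ≤ c → initial c t ≡ true
initial-true t≤c = Equivalence.to BP.T-≡ (ℕP.≤⇒≤ᵇ t≤c)

initial-false : ∀ {n c} {t : Fin n} → c < toℕ t → initial c t ≡ false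
initial-false {c = c} {t} c<t with toℕ t ≤ᵇ c | ℕP.≤ᵇ-reflects-≤ (toℕ t) c
... | true  | ofʸ t≤c = ⊥-elim (ℕP.<⇒≱ c<t t≤c)
... | false | _       = refl

initial-∧ : ∀ {n a b} → a ≤ b → (t : Fin n) → (initial a t ∧ initial b t) ≡ initial a t
initial-∧ {a = a} a≤b t with toℕ t ℕP.≤? a
... | yes t≤a rewrite initial-true {t = t} t≤a | initial-true {t = t} (ℕP.≤-trans t≤a a≤b) = refl
... | no  t≰a rewrite initial-false {t = t} (ℕP.≰⇒> t≰a) = refl

initial-step : ∀ {n c} (l : Fin n) → toℕ l ≢ c → initial c (inject₁ l) ≡ initial c (suc l)
initial-step {c = c} l l≢c with ℕP.<-cmp (toℕ l) c
... | tri< l<c _ _ = trans (initial-true (subst (_≤ c) (sym (FP.toℕ-inject₁ l)) (ℕP.<⇒≤ l<c)))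
                           (sym (initial-true l<c))
... | tri≈ _ l≡c _ = ⊥-elim (l≢c l≡c)
... | tri> _ _ c<l = trans (initial-false (subst (c <_) (sym (FP.toℕ-inject₁ l)) c<l))
                           (sym (initial-false (ℕP.m<n⇒m<1+n c<l)))

initial-suc : ∀ {n} c (t : Fin n) → initial (suc c) (suc t) ≡ initial c t
initial-suc c t with toℕ t
... | zero  = refl
... | suc _ = refl

count-initial : ∀ n c → c < n → count (initial {n} c) ≡ pos (suc c)
count-initial (suc n) zero    _         = cong (1ℤ +_) (∑-zero n)
count-initial (suc n) (suc c) (s≤s c<n) =
  cong (1ℤ +_) (trans (∑-cong {n} (λ t → cong ind (initial-suc c t))) (count-initial n c c<n))

module _ {f m : ℕ} {μ : Fin (suc m) → ℤ} (I : Fin f → Fin m → Subset (suc m))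
         (∣I∣≡ : ∀ j i → ∣ I j i ∣ ≡ suc (toℕ i))
         (μ≡ : ∀ t → μ t ≡ ∑ (λ j → ∑ (λ i → ind (lookup (I j i) t))))
         (B : Fin (suc m) → Bool) (k : Fin m) (#B≡ : count B ≡ pos (suc (toℕ k))) where

  private
    seg : Fin m → Fin (suc m) → Bool
    seg i = initial (toℕ i)

    shared : Fin f → Fin m → ℤ
    shared j i = count (λ s → B s ∧ lookup (I j i) s)

    -- capacity i = 1 + min(k, i) bounds shared j i, since |B| = k + 1 and |I j i| = i + 1.
    capacity : Fin m → ℤ
    capacity i = count (λ t → seg k t ∧ seg i t)

    count-seg : (i : Fin m) → count (seg i) ≡ pos (suc (toℕ i))
    count-seg i = count-initial (suc m) (toℕ i) (ℕP.m<n⇒m<1+n (FP.toℕ<n i))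

    ∑-B*μ : ∑ (λ s → ind (B s) * μ s) ≡ ∑ (λ j → ∑ (λ i → shared j i))
    ∑-B*μ = begin
      ∑ (λ s → ind (B s) * μ s)
        ≡⟨ ∑-cong (λ s → cong (ind (B s) *_) (μ≡ s)) ⟩
      ∑ (λ s → ind (B s) * ∑ (λ j → ∑ (λ i → ind (lookup (I j i) s))))
        ≡⟨ ∑[*∑]≡∑∑ (ind ∘ B) (λ s j → ∑ (λ i → ind (lookup (I j i) s))) ⟩
      ∑ (λ j → ∑ (λ s → ind (B s) * ∑ (λ i → ind (lookup (I j i) s))))
        ≡⟨ ∑-cong (λ j → ∑[*∑]≡∑∑ (ind ∘ B) (λ s i → ind (lookup (I j i) s))) ⟩
      ∑ (λ j → ∑ (λ i → ∑ (λ s → ind (B s) * ind (lookup (I j i) s))))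
        ≡⟨ ∑-cong (λ j → ∑-cong (λ i → ∑-cong (λ s → sym (ind-∧ (B s) (lookup (I j i) s))))) ⟩
      ∑ (λ j → ∑ (λ i → shared j i))
        ∎
      where open ≡-Reasoning

    ∑-seg*θ : pos f * ∑ (λ t → ind (seg k t) * θ m t) ≡ ∑ (λ (j : Fin f) → ∑ capacity)
    ∑-seg*θ = begin
      pos f * ∑ (λ t → ind (seg k t) * θ m t)
        ≡⟨ cong (pos f *_) (∑[*∑]≡∑∑ (ind ∘ seg k) (λ t i → ind (seg i t))) ⟩
      pos f * ∑ (λ i → ∑ (λ t → ind (seg k t) * ind (seg i t)))
        ≡⟨ cong (pos f *_) (∑-cong (λ i → ∑-cong (λ t → sym (ind-∧ (seg k t) (seg i t))))) ⟩
      pos f * ∑ capacity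
        ≡⟨ ∑-const f (∑ capacity) ⟨
      ∑ (λ (j : Fin f) → ∑ capacity)
        ∎
      where open ≡-Reasoning

    capacity-≥ : ∀ i → toℕ k ≤ toℕ i → capacity i ≡ count B
    capacity-≥ i k≤i = begin
      capacity i                       ≡⟨ ∑-cong {suc m} (cong ind ∘ initial-∧ k≤i) ⟩
      count (seg k)                    ≡⟨ count-seg k ⟩
      pos (suc (toℕ k))                ≡⟨ #B≡ ⟨
      count B                          ∎
      where open ≡-Reasoning

    capacity-≤ : ∀ j i → toℕ i ≤ toℕ k → capacity i ≡ count (lookup (I j i))
    capacity-≤ j i i≤k = begin
      capacity i
        ≡⟨ ∑-cong (λ t → cong ind (trans (BP.∧-comm (seg k t) (seg i t)) (initial-∧ i≤k t))) ⟩
      count (seg i)                    ≡⟨ count-seg i ⟩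
      pos (suc (toℕ i))                ≡⟨ cong pos (∣I∣≡ j i) ⟨
      pos ∣ I j i ∣                    ≡⟨ count-lookup (I j i) ⟩
      count (lookup (I j i))           ∎
      where open ≡-Reasoning

    shared≤capacity : ∀ j i → shared j i ℤ.≤ capacity i
    shared≤capacity j i with toℕ k ℕP.≤? toℕ i
    ... | yes k≤i = subst (shared j i ℤ.≤_) (sym (capacity-≥ i k≤i))
                          (count-mono (λ s → BP.∧-conicalˡ (B s) (lookup (I j i) s)))
    ... | no  k≰i = subst (shared j i ℤ.≤_) (sym (capacity-≤ j i (ℕP.<⇒≤ (ℕP.≰⇒> k≰i))))
                          (count-mono (λ s → BP.∧-conicalʳ (B s) (lookup (I j i) s)))

  module _ (extremal : ∑ (λ s → ind (B s) * μ s) ≡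
                       pos f * ∑ (λ t → ind (initial (toℕ k) t) * θ m t)) where

    private
      shared≡capacity : ∀ j i → shared j i ≡ capacity i
      shared≡capacity j i =
        ∑-≤∧≡⇒≗ (shared≤capacity j) (∑-≤∧≡⇒≗ (λ j → ∑-mono-≤ (shared≤capacity j)) total j) i
        where
        total : ∑ (λ j → ∑ (shared j)) ≡ ∑ (λ (j : Fin f) → ∑ capacity)
        total = trans (sym ∑-B*μ) (trans extremal ∑-seg*θ)

      B⊆I : ∀ j i → toℕ k ≤ toℕ i → B ⊆ᵇ lookup (I j i)
      B⊆I j i k≤i s Bs = BP.∧-conicalʳ (B s) _
        (count-⊆∧≡⇒⊇ (λ s → BP.∧-conicalˡ (B s) (lookup (I j i) s))
                     (trans (shared≡capacity j i) (capacity-≥ i k≤i)) s Bs)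

      I⊆B : ∀ j i → toℕ i ≤ toℕ k → lookup (I j i) ⊆ᵇ B
      I⊆B j i i≤k s Is = BP.∧-conicalˡ _ (lookup (I j i) s)
        (count-⊆∧≡⇒⊇ (λ s → BP.∧-conicalʳ (B s) (lookup (I j i) s))
                     (trans (shared≡capacity j i) (capacity-≤ j i i≤k)) s Is)

    extremal-gap : 1 ≤ f → ∀ s t → B s ≡ true → B t ≡ false → μ t ℤ.< μ s
    extremal-gap (s≤s z≤n) s t Bs Bt = begin-strict
      μ t                                          ≡⟨ μ≡ t ⟩
      ∑ (λ j → ∑ (λ i → ind (lookup (I j i) t)))   <⟨ ∑-mono-< (λ j → ∑-mono-≤ (member-≤ j)) zero
                                                                (∑-mono-< (member-≤ zero) k member-<) ⟩
      ∑ (λ j → ∑ (λ i → ind (lookup (I j i) s)))   ≡⟨ μ≡ s ⟨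
      μ s                                          ∎
      where
      open ℤP.≤-Reasoning
      t∉I : ∀ j i → toℕ i ≤ toℕ k → lookup (I j i) t ≡ false
      t∉I j i i≤k = BP.¬-not (λ It → BP.not-¬ Bt (I⊆B j i i≤k t It))
      member-≤ : ∀ j i → ind (lookup (I j i) t) ℤ.≤ ind (lookup (I j i) s)
      member-≤ j i with toℕ k ℕP.≤? toℕ i
      ... | yes k≤i = ind-mono (λ _ → B⊆I j i k≤i s Bs)
      ... | no  k≰i rewrite t∉I j i (ℕP.<⇒≤ (ℕP.≰⇒> k≰i)) = ind-nonneg _
      member-< : ind (lookup (I zero k) t) ℤ.< ind (lookup (I zero k) s)
      member-< = ind-< (t∉I zero k ℕP.≤-refl) (B⊆I zero k ℕP.≤-refl s Bs)

allᵇ-cong : ∀ {k} {g h : Fin k → Bool} → g ≗ h → allᵇ g ≡ allᵇ h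
allᵇ-cong {zero}  eq = refl
allᵇ-cong {suc k} eq = cong₂ _∧_ (eq zero) (allᵇ-cong (eq ∘ suc))

allᵇ-true : ∀ k → allᵇ {k} (λ _ → true) ≡ true
allᵇ-true zero    = refl
allᵇ-true (suc k) = allᵇ-true k

≤ᵇ-suc : ∀ a b → (suc a ≤ᵇ suc b) ≡ (a ≤ᵇ b)
≤ᵇ-suc zero    b = refl
≤ᵇ-suc (suc a) b = refl

sameBlockᵇ-sym : ∀ {m} (P : Fin m → Bool) i j → sameBlockᵇ P i j ≡ sameBlockᵇ P j i
sameBlockᵇ-sym {m} P i j = allᵇ-cong (λ k → cong (λ b → not b ∨ P k) (BP.∨-comm (left k) (right k)))
  where
  left right : Fin m → Bool
  left  k = (toℕ i ≤ᵇ toℕ k) ∧ (toℕ k <ᵇ toℕ j)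
  right k = (toℕ j ≤ᵇ toℕ k) ∧ (toℕ k <ᵇ toℕ i)

sameBlockᵇ-suc-suc : ∀ {m} (P : Fin (suc m) → Bool) i j →
                     sameBlockᵇ P (suc i) (suc j) ≡ sameBlockᵇ (P ∘ suc) i j
sameBlockᵇ-suc-suc P i j = allᵇ-cong (λ k → cong (λ b → not b ∨ P (suc k)) (betweenᵇ-suc k))
  where
  betweenᵇ-suc : ∀ k → betweenᵇ (suc k) (suc i) (suc j) ≡ betweenᵇ k i j
  betweenᵇ-suc k = cong₂ (λ x y → (x ∧ (toℕ k <ᵇ toℕ j)) ∨ (y ∧ (toℕ k <ᵇ toℕ i)))
                         (≤ᵇ-suc (toℕ i) (toℕ k)) (≤ᵇ-suc (toℕ j) (toℕ k))

sameBlockᵇ-zero-suc : ∀ {m} (P : Fin (suc m) → Bool) j →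
                      sameBlockᵇ P zero (suc j) ≡ (P zero ∧ sameBlockᵇ (P ∘ suc) zero j)
sameBlockᵇ-zero-suc P j =
  cong (P zero ∧_) (allᵇ-cong (λ k → cong (λ b → not b ∨ P (suc k)) (betweenᵇ-suc k)))
  where
  betweenᵇ-suc : ∀ k → betweenᵇ (suc k) zero (suc j) ≡ betweenᵇ k zero j
  betweenᵇ-suc k = cong ((toℕ k <ᵇ toℕ j) ∨_)
                        (trans (BP.∧-zeroʳ (suc (toℕ j) ≤ᵇ suc (toℕ k)))
                               (sym (BP.∧-zeroʳ (toℕ j ≤ᵇ toℕ k))))

sameBlockᵇ-refl : ∀ {m} (P : Fin m → Bool) i → sameBlockᵇ P i i ≡ true
sameBlockᵇ-refl {m}     P zero    = allᵇ-true m
sameBlockᵇ-refl {suc m} P (suc i) = trans (sameBlockᵇ-suc-suc P i i) (sameBlockᵇ-refl (P ∘ suc) i)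

sameBlockᵇ-zero-suc⇒root : ∀ {m} (P : Fin m → Bool) s →
                           sameBlockᵇ P zero (suc s) ≡ true → P s ≡ true
sameBlockᵇ-zero-suc⇒root {suc m} P zero    same =
  BP.∧-conicalˡ _ _ (trans (sym (sameBlockᵇ-zero-suc P zero)) same)
sameBlockᵇ-zero-suc⇒root {suc m} P (suc s) same =
  sameBlockᵇ-zero-suc⇒root (P ∘ suc) s
    (BP.∧-conicalʳ _ _ (trans (sym (sameBlockᵇ-zero-suc P (suc s))) same))

BlockClosed : ∀ {m} → (Fin m → Bool) → (Fin (suc m) → Bool) → Set
BlockClosed P g = ∀ a → P a ≡ true → g (inject₁ a) ≡ g (suc a)

blockClosed-zero : ∀ {m} {P : Fin m → Bool} {g : Fin (suc m) → Bool} → BlockClosed P g →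
                   ∀ j → sameBlockᵇ P zero j ≡ true → g zero ≡ g j
blockClosed-zero                 closed zero    _    = refl
blockClosed-zero {suc m} {P} {g} closed (suc j) same =
  trans (closed zero (BP.∧-conicalˡ _ _ same′))
        (blockClosed-zero {P = P ∘ suc} {g ∘ suc} (closed ∘ suc) j (BP.∧-conicalʳ _ _ same′))
  where
  same′ : (P zero ∧ sameBlockᵇ (P ∘ suc) zero j) ≡ true
  same′ = trans (sym (sameBlockᵇ-zero-suc P j)) same

blockClosed-sameBlock : ∀ {m} {P : Fin m → Bool} {g : Fin (suc m) → Bool} → BlockClosed P g →
                        ∀ i j → sameBlockᵇ P i j ≡ true → g i ≡ g j
blockClosed-sameBlock                 closed zero    j       same = blockClosed-zero closed j same
blockClosed-sameBlock {suc m} {P} {g} closed (suc i) zero    same =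
  sym (blockClosed-zero {P = P} {g} closed (suc i) (trans (sameBlockᵇ-sym P zero (suc i)) same))
blockClosed-sameBlock {suc m} {P} {g} closed (suc i) (suc j) same =
  blockClosed-sameBlock {P = P ∘ suc} {g ∘ suc} (closed ∘ suc) i j
    (trans (sym (sameBlockᵇ-suc-suc P i j)) same)

blockLeader : ∀ {m} → (Fin m → Bool) → Fin (suc m) → Bool
blockLeader P zero    = true
blockLeader P (suc a) = not (P a)

∑-blockLeader-sameBlock : ∀ {m} (P : Fin m → Bool) j →
                          ∑ (λ s → ind (blockLeader P s ∧ sameBlockᵇ P s j)) ≡ 1ℤ
∑-blockLeader-sameBlock {zero}  P zero = refl
∑-blockLeader-sameBlock {suc m} P zero =
  cong₂ _+_ (cong ind (sameBlockᵇ-refl P zero)) (trans (∑-cong not-leader) (∑-zero (suc m)))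
  where
  not-leader : ∀ s → ind (not (P s) ∧ sameBlockᵇ P (suc s) zero) ≡ 0ℤ
  not-leader s with sameBlockᵇ P (suc s) zero in same
  ... | true  rewrite sameBlockᵇ-zero-suc⇒root P s (trans (sameBlockᵇ-sym P zero (suc s)) same) = refl
  ... | false = cong ind (BP.∧-zeroʳ (not (P s)))
∑-blockLeader-sameBlock {suc m} P (suc j) = begin
  ∑ (λ s → ind (blockLeader P s ∧ sameBlockᵇ P s (suc j)))
    ≡⟨ cong₂ _+_ (cong ind (sameBlockᵇ-zero-suc P j))
                 (∑-cong (λ s → cong (λ b → ind (not (P s) ∧ b)) (sameBlockᵇ-suc-suc P s j))) ⟩
  ind (P zero ∧ S) + (ind (not (P zero) ∧ S) + R)  ≡⟨ split (P zero) ⟩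
  ind S + R                                        ≡⟨ ∑-blockLeader-sameBlock (P ∘ suc) j ⟩
  1ℤ                                               ∎
  where
  open ≡-Reasoning
  S : Bool
  S = sameBlockᵇ (P ∘ suc) zero j
  R : ℤ
  R = ∑ (λ r → ind (not (P (suc r)) ∧ sameBlockᵇ (P ∘ suc) (suc r) j))
  split : ∀ b → ind (b ∧ S) + (ind (not b ∧ S) + R) ≡ ind S + R
  split true  = cong (ind S +_) (ℤP.+-identityˡ R)
  split false = ℤP.+-identityˡ _

-- A block-closed sum is collected block by block, each block counted once through its leader.
∑-blockClosed : ∀ {m} {P : Fin m → Bool} {A : Fin (suc m) → Bool} → BlockClosed P A →
                (v : Fin (suc m) → ℤ) →
                ∑ (λ s → ind (A s) * v s) ≡ ∑ (λ t → ind (blockLeader P t ∧ A t) * blockSum P v t)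
∑-blockClosed {m} {P} {A} closed v = begin
  ∑ (λ s → ind (A s) * v s)
    ≡⟨ ∑-cong (λ s → sym (trans (cong (ind (A s) * v s *_) (∑-blockLeader-sameBlock P s))
                                (ℤP.*-identityʳ (ind (A s) * v s)))) ⟩
  ∑ (λ s → ind (A s) * v s * ∑ (λ t → ind (L t ∧ sameBlockᵇ P t s)))
    ≡⟨ ∑[*∑]≡∑∑ (λ s → ind (A s) * v s) (λ s t → ind (L t ∧ sameBlockᵇ P t s)) ⟩
  ∑ (λ t → ∑ (λ s → ind (A s) * v s * ind (L t ∧ sameBlockᵇ P t s)))
    ≡⟨ ∑-cong (λ t → ∑-cong (λ s → regroup (A s) (L t) (sameBlockᵇ P t s) (v s)
                                           (blockClosed-sameBlock closed t s))) ⟩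
  ∑ (λ t → ∑ (λ s → ind (L t ∧ A t) * (if sameBlockᵇ P t s then v s else 0ℤ)))
    ≡⟨ ∑-cong (λ t → ∑-*ˡ (ind (L t ∧ A t)) (λ s → if sameBlockᵇ P t s then v s else 0ℤ)) ⟩
  ∑ (λ t → ind (L t ∧ A t) * blockSum P v t)
    ∎
  where
  open ≡-Reasoning
  L : Fin (suc m) → Bool
  L = blockLeader P
  regroup : ∀ {a′} a l b x → (b ≡ true → a′ ≡ a) →
            ind a * x * ind (l ∧ b) ≡ ind (l ∧ a′) * (if b then x else 0ℤ)
  regroup      a false b     x _    = ℤP.*-zeroʳ (ind a * x)
  regroup {a′} a true  false x _    = trans (ℤP.*-zeroʳ (ind a * x)) (sym (ℤP.*-zeroʳ (ind a′)))
  regroup      a true  true  x a′≡a rewrite a′≡a refl = ℤP.*-identityʳ (ind a * x)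

blockSum-ind : ∀ {m} (P : Fin m → Bool) v i → blockSum P v i ≡ ∑ (λ s → ind (sameBlockᵇ P i s) * v s)
blockSum-ind P v i = ∑-cong (λ s → if-ind (sameBlockᵇ P i s) (v s))
  where
  if-ind : ∀ b x → (if b then x else 0ℤ) ≡ ind b * x
  if-ind true  x = sym (ℤP.*-identityˡ x)
  if-ind false x = refl

blockSize-count : ∀ {m} (P : Fin m → Bool) i → pos (blockSize P i) ≡ count (sameBlockᵇ P i)
blockSize-count P i =
  trans (∑ℕ-pos (λ j → if sameBlockᵇ P i j then 1 else 0)) (∑-cong (λ j → pos-if (sameBlockᵇ P i j)))
  where
  pos-if : ∀ b → pos (if b then 1 else 0) ≡ ind b
  pos-if true  = refl
  pos-if false = refl

blockSize-pos : ∀ {m} (P : Fin m → Bool) i → 0 < blockSize P i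
blockSize-pos P i = ℤP.drop‿+<+ (subst (0ℤ ℤ.<_) (sym (blockSize-count P i))
                                       (count-pos {B = sameBlockᵇ P i} i (sameBlockᵇ-refl P i)))

avg-cross : ∀ x y {a b} → 0 < a → 0 < b → avg x a ≡ avg y b → x * pos b ≡ y * pos a
avg-cross x y {suc a} {suc b} _ _ eq with ℚP./-injective-≃ (mkℚᵘ x a) (mkℚᵘ y b) eq
... | *≡* cross = cross

avgW-cross : ∀ {m} (P : Fin m → Bool) v i j → avgW P v i ≡ avgW P v j →
             blockSum P v i * count (sameBlockᵇ P j) ≡ blockSum P v j * count (sameBlockᵇ P i)
avgW-cross P v i j eq =
  subst₂ (λ x y → blockSum P v i * x ≡ blockSum P v j * y) (blockSize-count P j) (blockSize-count P i)
         (avg-cross _ _ (blockSize-pos P i) (blockSize-pos P j) eq)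

separated-cross-< : ∀ {n} (μ : Fin n → ℤ) {G H : Fin n → Bool} a b → G a ≡ true → H b ≡ true →
                    (∀ s t → G s ≡ true → H t ≡ true → μ t ℤ.< μ s) →
                    ∑ (λ t → ind (H t) * μ t) * count G ℤ.< ∑ (λ s → ind (G s) * μ s) * count H
separated-cross-< μ {G} {H} a b Ga Hb sep = begin-strict
  ∑ (λ t → ind (H t) * μ t) * count G
    ≡⟨ ℤP.*-comm (∑ (λ t → ind (H t) * μ t)) (count G) ⟩
  count G * ∑ (λ t → ind (H t) * μ t)
    ≡⟨ ∑*∑≡∑∑ (ind ∘ G) (λ t → ind (H t) * μ t) ⟩
  ∑ (λ s → ∑ (λ t → ind (G s) * (ind (H t) * μ t)))
    <⟨ ∑-mono-< (λ s → ∑-mono-≤ (term-≤ s)) a (∑-mono-< (term-≤ a) b (term-< Ga Hb)) ⟩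
  ∑ (λ s → ∑ (λ t → ind (G s) * (ind (H t) * μ s)))
    ≡⟨ ∑-cong (λ s → ∑-cong (λ t → reassoc (ind (G s)) (ind (H t)) (μ s))) ⟩
  ∑ (λ s → ∑ (λ t → ind (G s) * μ s * ind (H t)))
    ≡⟨ ∑*∑≡∑∑ (λ s → ind (G s) * μ s) (ind ∘ H) ⟨
  ∑ (λ s → ind (G s) * μ s) * count H
    ∎
  where
  open ℤP.≤-Reasoning
  term-≤ : ∀ s t → ind (G s) * (ind (H t) * μ t) ℤ.≤ ind (G s) * (ind (H t) * μ s)
  term-≤ s t = ind*-mono-≤ (G s) (λ Gs → ind*-mono-≤ (H t) (λ Ht → ℤP.<⇒≤ (sep s t Gs Ht)))
  term-< : ∀ {s t} → G s ≡ true → H t ≡ true →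
           ind (G s) * (ind (H t) * μ t) ℤ.< ind (G s) * (ind (H t) * μ s)
  term-< Gs Ht = ind*-mono-< Gs (ind*-mono-< Ht (sep _ _ Gs Ht))
  reassoc : ∀ g h x → g * (h * x) ≡ g * x * h
  reassoc g h x = trans (cong (g *_) (ℤP.*-comm h x)) (sym (ℤP.*-assoc g x h))

permutation-injective : ∀ {n} (π : Permutation′ n) {a b} → π ⟨$⟩ʳ a ≡ π ⟨$⟩ʳ b → a ≡ b
permutation-injective π {a} {b} eq = trans (sym (inverseˡ π)) (trans (cong (π ⟨$⟩ˡ_) eq) (inverseˡ π))

DominantQ-cong : ∀ {m} {x y : Fin (suc m) → ℚ} → x ≗ y → DominantQ x → DominantQ y
DominantQ-cong x≗y dom k = subst₂ ℚ._≤_ (x≗y (suc k)) (x≗y (inject₁ k)) (dom k)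

dominant-antitone : ∀ {m} {x : Fin (suc m) → ℚ} → DominantQ x →
                    ∀ {i j} → toℕ i ≤ toℕ j → x j ℚ.≤ x i
dominant-antitone {zero}          dom {zero}  {zero}  _         = ℚP.≤-refl
dominant-antitone {suc m}         dom {zero}  {zero}  _         = ℚP.≤-refl
dominant-antitone {suc m} {x}     dom {zero}  {suc j} _         =
  ℚP.≤-trans (dominant-antitone {x = x ∘ suc} (dom ∘ suc) {zero} {j} z≤n) (dom zero)
dominant-antitone {suc m} {x}     dom {suc i} {suc j} (s≤s i≤j) =
  dominant-antitone {x = x ∘ suc} (dom ∘ suc) i≤j

dominant-permute-≤ : ∀ {m} {x : Fin (suc m) → ℚ} (π : Permutation′ (suc m)) →
                     DominantQ x → DominantQ (λ i → x (π ⟨$⟩ʳ i)) → ∀ i → x (π ⟨$⟩ʳ i) ℚ.≤ x i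
dominant-permute-≤ {x = x} π dom dom∘π i with FP.injective⇒existsPivot (permutation-injective π) i
... | j , j≤i , i≤πj =
  ℚP.≤-trans (dominant-antitone {x = x ∘ (π ⟨$⟩ʳ_)} dom∘π j≤i) (dominant-antitone dom i≤πj)

dominant-permute-≡ : ∀ {m} {x : Fin (suc m) → ℚ} (π : Permutation′ (suc m)) →
                     DominantQ x → DominantQ (λ i → x (π ⟨$⟩ʳ i)) → ∀ i → x (π ⟨$⟩ʳ i) ≡ x i
dominant-permute-≡ {x = x} π dom dom∘π i = ℚP.≤-antisym (dominant-permute-≤ π dom dom∘π i) (begin
  x i                           ≡⟨ cong x (inverseʳ π) ⟨
  x (π ⟨$⟩ʳ (π ⟨$⟩ˡ i))          ≤⟨ dominant-permute-≤ (flip π) dom∘π dom∘π∘π⁻¹ i ⟩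
  x (π ⟨$⟩ʳ i)                  ∎)
  where
  open ℚP.≤-Reasoning
  dom∘π∘π⁻¹ : DominantQ (λ j → x (π ⟨$⟩ʳ (π ⟨$⟩ˡ j)))
  dom∘π∘π⁻¹ = DominantQ-cong (λ j → cong x (sym (inverseʳ π {j}))) dom

dominant-act-unique : ∀ {m} (x : Fin (suc m) → ℚ) (u v : Permutation′ (suc m)) →
                      DominantQ (act u x) → DominantQ (act v x) → act u x ≗ act v x
dominant-act-unique x u v dom-u dom-v i = begin
  act u x i                            ≡⟨ dominant-permute-≡ π dom-u dom-u∘π i ⟨
  act u x (u ⟨$⟩ʳ (v ⟨$⟩ˡ i))          ≡⟨ u∘π≗v i ⟩
  act v x i                            ∎
  where
  open ≡-Reasoning
  π : Permutation′ _
  π = flip v ∘ₚ u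
  u∘π≗v : ∀ i → act u x (π ⟨$⟩ʳ i) ≡ act v x i
  u∘π≗v i = cong x (inverseˡ u)
  dom-u∘π : DominantQ (λ i → act u x (π ⟨$⟩ʳ i))
  dom-u∘π = DominantQ-cong (sym ∘ u∘π≗v) dom-v

dominant-flat-between : ∀ {m} {z : Fin (suc m) → ℚ} → DominantQ z →
                        ∀ {i j k} → z i ≡ z j → Between k i j → z (inject₁ k) ≡ z (suc k)
dominant-flat-between {z = z} dom {i} {j} {k} zi≡zj (inj₁ (i≤k , k<j)) = ℚP.≤-antisym (begin
  z (inject₁ k)   ≤⟨ dominant-antitone dom (subst (toℕ i ≤_) (sym (FP.toℕ-inject₁ k)) i≤k) ⟩
  z i             ≡⟨ zi≡zj ⟩
  z j             ≤⟨ dominant-antitone dom k<j ⟩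
  z (suc k)       ∎) (dom k)
  where open ℚP.≤-Reasoning
dominant-flat-between dom zi≡zj (inj₂ j≤k<i) = dominant-flat-between dom (sym zi≡zj) (inj₁ j≤k<i)

e-suc : ∀ {n} (a t : Fin n) → e (suc a) (suc t) ≡ e a t
e-suc a t with a Fin.≟ t
... | yes _ = refl
... | no  _ = refl

∑-e* : ∀ {n} (a : Fin n) (g : Fin n → ℤ) → ∑ (λ t → e a t * g t) ≡ g a
∑-e* {suc n} zero g = trans (cong₂ _+_ (ℤP.*-identityˡ (g zero)) (∑-zero n)) (ℤP.+-identityʳ (g zero))
∑-e* {suc n} (suc a) g = begin
  0ℤ * g zero + ∑ (λ t → e (suc a) (suc t) * g (suc t)) ≡⟨ ℤP.+-identityˡ _ ⟩
  ∑ (λ t → e (suc a) (suc t) * g (suc t))              ≡⟨ ∑-cong (λ t → cong (_* g (suc t)) (e-suc a t)) ⟩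
  ∑ (λ t → e a t * g (suc t))                          ≡⟨ ∑-e* a (g ∘ suc) ⟩
  g (suc a)                                            ∎
  where open ≡-Reasoning

α≡1⇒≡inject₁ : ∀ {m} {l : Fin m} {t} → α l t ≡ 1ℤ → t ≡ inject₁ l
α≡1⇒≡inject₁ {l = l} {t} eq with inject₁ l Fin.≟ t | suc l Fin.≟ t
... | yes l≡t | _     = sym l≡t
... | no  _   | yes _ with () ← eq
... | no  _   | no  _ with () ← eq

α≡-1⇒≡suc : ∀ {m} {l : Fin m} {t} → α l t ≡ - 1ℤ → t ≡ suc l
α≡-1⇒≡suc {l = l} {t} eq with inject₁ l Fin.≟ t | suc l Fin.≟ t
... | _       | yes l≡t = sym l≡t
... | yes _   | no  _   with () ← eq
... | no  _   | no  _   with () ← eq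

inject₁≢suc : ∀ {m} (a : Fin m) → inject₁ a ≢ suc a
inject₁≢suc a eq = ℕP.1+n≢n (sym (trans (sym (FP.toℕ-inject₁ a)) (cong toℕ eq)))

α-inject₁ : ∀ {m} (a : Fin m) → α a (inject₁ a) ≡ 1ℤ
α-inject₁ a with inject₁ a Fin.≟ inject₁ a | suc a Fin.≟ inject₁ a
... | yes _ | no  _   = refl
... | no  n | _       = ⊥-elim (n refl)
... | yes _ | yes eq  = ⊥-elim (inject₁≢suc a (sym eq))

α-suc : ∀ {m} (a : Fin m) → α a (suc a) ≡ - 1ℤ
α-suc a with inject₁ a Fin.≟ suc a | suc a Fin.≟ suc a
... | no  _  | yes _ = refl
... | _      | no  n = ⊥-elim (n refl)
... | yes eq | yes _ = ⊥-elim (inject₁≢suc a eq)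

act-α : ∀ {m} (w : Permutation′ (suc m)) {a l : Fin m} → (∀ t → act w (α a) t ≡ α l t) →
        w ⟨$⟩ʳ inject₁ a ≡ inject₁ l × w ⟨$⟩ʳ suc a ≡ suc l
act-α w {a} h = α≡1⇒≡inject₁ (trans (sym (h _)) (trans (cong (α a) (inverseˡ w)) (α-inject₁ a)))
              , α≡-1⇒≡suc (trans (sym (h _)) (trans (cong (α a) (inverseˡ w)) (α-suc a)))

∑-initial*α : ∀ {m} (k l : Fin m) → ∑ (λ t → ind (initial (toℕ k) t) * α l t) ≡ e k l
∑-initial*α {m} k l = begin
  ∑ (λ t → L t * α l t)
    ≡⟨ ∑-cong (λ t → solve 3 (λ x a b → x :* (a :- b) := a :* x :- b :* x) refl
                             (L t) (e (inject₁ l) t) (e (suc l) t)) ⟩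
  ∑ (λ t → e (inject₁ l) t * L t - e (suc l) t * L t)
    ≡⟨ ∑-- (λ t → e (inject₁ l) t * L t) (λ t → e (suc l) t * L t) ⟩
  ∑ (λ t → e (inject₁ l) t * L t) - ∑ (λ t → e (suc l) t * L t)
    ≡⟨ cong₂ _-_ (∑-e* (inject₁ l) L) (∑-e* (suc l) L) ⟩
  L (inject₁ l) - L (suc l)
    ≡⟨ step ⟩
  e k l
    ∎
  where
  open ≡-Reasoning
  L : Fin (suc m) → ℤ
  L t = ind (initial (toℕ k) t)
  step : L (inject₁ l) - L (suc l) ≡ e k l
  step with k Fin.≟ l
  ... | yes refl rewrite initial-true {t = inject₁ k} (ℕP.≤-reflexive (FP.toℕ-inject₁ k))
                       | initial-false {t = suc k} (ℕP.n<1+n (toℕ k)) = refl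
  ... | no  k≢l  rewrite initial-step {c = toℕ k} l (λ l≡k → k≢l (FP.toℕ-injective (sym l≡k))) =
    ℤP.+-inverseʳ (L (suc l))

rootCoeffs-partialSum : ∀ {f m} {v : Fin (suc m) → ℤ} {w : Permutation′ (suc m)} {c : Fin m → ℤ} →
                        RootCoeffs f m v w c → ∀ k →
                        ∑ (λ t → ind (initial (toℕ k) t) * (pos f * θ m t - act w v t)) ≡ c k
rootCoeffs-partialSum {f} {m} {v} {w} {c} coeffs k = begin
  ∑ (λ t → L t * (pos f * θ m t - act w v t))
    ≡⟨ ∑-cong (λ t → cong (L t *_) (coeffs t)) ⟩
  ∑ (λ t → L t * ∑ (λ l → c l * α l t))
    ≡⟨ ∑[*∑]≡∑∑ L (λ t l → c l * α l t) ⟩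
  ∑ (λ l → ∑ (λ t → L t * (c l * α l t)))
    ≡⟨ ∑-cong (λ l → trans (∑-cong (λ t → solve 3 (λ x y z → x :* (y :* z) := y :* (x :* z)) refl
                                                   (L t) (c l) (α l t)))
                           (∑-*ˡ (c l) (λ t → L t * α l t))) ⟩
  ∑ (λ l → c l * ∑ (λ t → L t * α l t))
    ≡⟨ ∑-cong (λ l → trans (cong (c l *_) (∑-initial*α k l)) (ℤP.*-comm (c l) (e k l))) ⟩
  ∑ (λ l → e k l * c l)
    ≡⟨ ∑-e* k c ⟩
  c k
    ∎
  where
  open ≡-Reasoning
  L : Fin (suc m) → ℤ
  L t = ind (initial (toℕ k) t)

rootCoeffs-zero⇒extremal : ∀ {f m} {v : Fin (suc m) → ℤ} {w : Permutation′ (suc m)} {c : Fin m → ℤ} →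
                           RootCoeffs f m v w c → ∀ k → c k ≡ 0ℤ →
                           ∑ (λ t → ind (initial (toℕ k) t) * act w v t) ≡
                           pos f * ∑ (λ t → ind (initial (toℕ k) t) * θ m t)
rootCoeffs-zero⇒extremal {f} {m} {v} {w} {c} coeffs k ck≡0 = sym (ℤP.i-j≡0⇒i≡j _ _ (begin
  pos f * ∑ (λ t → L t * θ m t) - ∑ (λ t → L t * act w v t)
    ≡⟨ cong (_- ∑ (λ t → L t * act w v t)) (∑-*ˡ (pos f) (λ t → L t * θ m t)) ⟨
  ∑ (λ t → pos f * (L t * θ m t)) - ∑ (λ t → L t * act w v t)
    ≡⟨ ∑-- (λ t → pos f * (L t * θ m t)) (λ t → L t * act w v t) ⟨
  ∑ (λ t → pos f * (L t * θ m t) - L t * act w v t)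
    ≡⟨ ∑-cong (λ t → solve 4 (λ f x θ y → f :* (x :* θ) :- x :* y := x :* (f :* θ :- y)) refl
                              (pos f) (L t) (θ m t) (act w v t)) ⟩
  ∑ (λ t → L t * (pos f * θ m t - act w v t))
    ≡⟨ rootCoeffs-partialSum {f} {m} {v} {w} {c} coeffs k ⟩
  c k
    ≡⟨ ck≡0 ⟩
  0ℤ
    ∎))
  where
  open ≡-Reasoning
  L : Fin (suc m) → ℤ
  L t = ind (initial (toℕ k) t)

preimage-initial-blockClosed : ∀ {m} {P : Fin m → Bool} {w : Permutation′ (suc m)} →
                               MapsIntoS w P → ∀ k →
                               (∀ a → P a ≡ true → w ⟨$⟩ʳ inject₁ a ≢ inject₁ k) →
                               BlockClosed P (λ s → initial (toℕ k) (w ⟨$⟩ʳ s))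
preimage-initial-blockClosed {w = w} maps k avoids a Pa with maps a Pa
... | l , wα≡α with act-α w wα≡α
... | wa≡l , wsa≡sl = begin
  initial (toℕ k) (w ⟨$⟩ʳ inject₁ a) ≡⟨ cong (initial (toℕ k)) wa≡l ⟩
  initial (toℕ k) (inject₁ l)        ≡⟨ initial-step l l≢k ⟩
  initial (toℕ k) (suc l)            ≡⟨ cong (initial (toℕ k)) wsa≡sl ⟨
  initial (toℕ k) (w ⟨$⟩ʳ suc a)     ∎
  where
  open ≡-Reasoning
  l≢k : toℕ l ≢ toℕ k
  l≢k l≡k = avoids a Pa (trans wa≡l (cong inject₁ (FP.toℕ-injective l≡k)))

flat∧zero-coeff⇒root :
  ∀ {f m} {P : Fin m → Bool} {λ₀ μ : Fin (suc m) → ℤ} {w : Permutation′ (suc m)} {c : Fin m → ℤ} →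
  1 ≤ f → IsWeightL f m μ → ResEq P λ₀ μ → MapsIntoS w P → RootCoeffs f m λ₀ w c →
  ∀ k → c k ≡ 0ℤ → act w (avgW P λ₀) (inject₁ k) ≡ act w (avgW P λ₀) (suc k) →
  ∃ λ a → P a ≡ true × w ⟨$⟩ʳ inject₁ a ≡ inject₁ k
flat∧zero-coeff⇒root {f} {m} {P} {λ₀} {μ} {w} {c} f≥1 (I , ∣I∣≡ , μ≡) resEq maps coeffs k ck≡0 flat
  with FP.any? (λ a → (P a BP.≟ true) ×-dec (w ⟨$⟩ʳ inject₁ a FP.≟ inject₁ k))
... | yes root    = root
... | no  no-root = ⊥-elim (ℤP.<-irrefl cross-≡ cross-<)
  where
  A : Fin (suc m) → Bool
  A s = initial (toℕ k) (w ⟨$⟩ʳ s)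

  A-closed : BlockClosed P A
  A-closed = preimage-initial-blockClosed {w = w} maps k (λ a Pa eq → no-root (a , Pa , eq))

  #A : count A ≡ pos (suc (toℕ k))
  #A = trans (count-permute w (initial (toℕ k)))
             (count-initial (suc m) (toℕ k) (ℕP.m<n⇒m<1+n (FP.toℕ<n k)))

  A-extremal : ∑ (λ s → ind (A s) * μ s) ≡ pos f * ∑ (λ t → ind (initial (toℕ k) t) * θ m t)
  A-extremal = begin
    ∑ (λ s → ind (A s) * μ s)
      ≡⟨ ∑-blockClosed {P = P} {A} A-closed μ ⟩
    ∑ (λ t → ind (blockLeader P t ∧ A t) * blockSum P μ t)
      ≡⟨ ∑-cong (λ t → cong (ind (blockLeader P t ∧ A t) *_) (resEq t)) ⟨
    ∑ (λ t → ind (blockLeader P t ∧ A t) * blockSum P λ₀ t)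
      ≡⟨ ∑-blockClosed {P = P} {A} A-closed λ₀ ⟨
    ∑ (λ s → ind (A s) * λ₀ s)
      ≡⟨ ∑-act w (ind ∘ initial (toℕ k)) λ₀ ⟨
    ∑ (λ t → ind (initial (toℕ k) t) * act w λ₀ t)
      ≡⟨ rootCoeffs-zero⇒extremal {f} {m} {λ₀} {w} {c} coeffs k ck≡0 ⟩
    pos f * ∑ (λ t → ind (initial (toℕ k) t) * θ m t)
      ∎
    where open ≡-Reasoning

  a₀ b₀ : Fin (suc m)
  a₀ = w ⟨$⟩ˡ inject₁ k
  b₀ = w ⟨$⟩ˡ suc k

  G H : Fin (suc m) → Bool
  G = sameBlockᵇ P a₀
  H = sameBlockᵇ P b₀

  G⊆A : G ⊆ᵇ A
  G⊆A s Gs = trans (sym (blockClosed-sameBlock A-closed a₀ s Gs))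
                   (trans (cong (initial (toℕ k)) (inverseʳ w))
                          (initial-true (ℕP.≤-reflexive (FP.toℕ-inject₁ k))))

  H∩A≡∅ : ∀ t → H t ≡ true → A t ≡ false
  H∩A≡∅ t Ht = trans (sym (blockClosed-sameBlock A-closed b₀ t Ht))
                     (trans (cong (initial (toℕ k)) (inverseʳ w)) (initial-false (ℕP.n<1+n (toℕ k))))

  gap : ∀ s t → G s ≡ true → H t ≡ true → μ t ℤ.< μ s
  gap s t Gs Ht = extremal-gap I ∣I∣≡ μ≡ A k #A A-extremal f≥1 s t (G⊆A s Gs) (H∩A≡∅ t Ht)

  cross-< : ∑ (λ t → ind (H t) * μ t) * count G ℤ.< ∑ (λ s → ind (G s) * μ s) * count H
  cross-< = separated-cross-< μ a₀ b₀ (sameBlockᵇ-refl P a₀) (sameBlockᵇ-refl P b₀) gap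

  cross-≡ : ∑ (λ t → ind (H t) * μ t) * count G ≡ ∑ (λ s → ind (G s) * μ s) * count H
  cross-≡ = begin
    ∑ (λ t → ind (H t) * μ t) * count G  ≡⟨ cong (_* count G) (trans (resEq b₀) (blockSum-ind P μ b₀)) ⟨
    blockSum P λ₀ b₀ * count G          ≡⟨ avgW-cross P λ₀ a₀ b₀ flat ⟨
    blockSum P λ₀ a₀ * count H          ≡⟨ cong (_* count H) (trans (resEq a₀) (blockSum-ind P μ a₀)) ⟩
    ∑ (λ s → ind (G s) * μ s) * count H  ∎
    where open ≡-Reasoning

lemma2p2p2p10 : (m f : ℕ) → 1 ≤ f → (P : Fin m → Bool) →
    (λ₀ μ : Fin (suc m) → ℤ) → IsWeightL f m μ → ResEq P λ₀ μ →
    (w w' w'' : Permutation′ (suc m)) →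
    InWC P λ₀ w → InWC P λ₀ w' → InWC P λ₀ w'' →
    (c : Fin m → ℤ) → RootCoeffs f m λ₀ w'' c →
    InW (rootsPC P w'' c) (λ j → w' ⟨$⟩ʳ (w ⟨$⟩ˡ j))
lemma2p2p2p10 m f f≥1 P λ₀ μ weight resEq w w' w'' (_ , dom) (_ , dom') (maps'' , dom'') c coeffs j k between
  with c k ℤ.≟ 0ℤ
... | no  ck≢0 = inj₂ ck≢0
... | yes ck≡0
  with flat∧zero-coeff⇒root {P = P} {λ₀} {μ} {w''} {c} f≥1 weight resEq maps'' coeffs k ck≡0 flat
  where
  λ′ z : Fin (suc m) → ℚ
  λ′ = avgW P λ₀
  z  = act w'' λ′
  flat : z (inject₁ k) ≡ z (suc k)
  flat = dominant-flat-between dom'' (begin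
    z j                             ≡⟨ dominant-act-unique λ′ w'' w dom'' dom j ⟩
    act w λ′ j                      ≡⟨ cong λ′ (inverseˡ w') ⟨
    act w' λ′ (w' ⟨$⟩ʳ (w ⟨$⟩ˡ j))  ≡⟨ dominant-act-unique λ′ w'' w' dom'' dom' _ ⟨
    z (w' ⟨$⟩ʳ (w ⟨$⟩ˡ j))          ∎) between
    where open ≡-Reasoning
... | a , Pa , w''a≡k with maps'' a Pa
... | l , w''α≡α = inj₁ (a , Pa , subst (λ l → ∀ t → act w'' (α a) t ≡ α l t) l≡k w''α≡α)
  where
  l≡k : l ≡ k
  l≡k = FP.inject₁-injective (trans (sym (proj₁ (act-α w'' {a} {l} w''α≡α))) w''a≡k)
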